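{- Both SINGLE-REF (for any parameters $t, r$) and OPTIMISTIC (for any parameter $t$) are monotone: for all $i \in \{1,\dots,n-1\}$, $p_i \ge p_{i+1}$, where $p_i$ is the probability that the algorithm accepts item $v_i$.
   Context: $k$-secretary problem: $n$ items with distinct values $v_1 > v_2 > \dots > v_n$ arrive in a uniformly random order (all $n!$ permutations equally likely); an algorithm may accept at most $k$ items, deciding immediately and irrevocably on arrival. An algorithm is monotone if $p_i \ge p_j$ for any two items $v_i > v_j$. SINGLE-REF with parameters $t \in \{k+1,\dots,n-k\}$ and $r \in \{1,\dots,k\}$: reject the first $t-1$ items; let $s_r$ be the $r$-th best among them; then accept the first $k$ items that are better than $s_r$. OPTIMISTIC with parameter $t \in \{k+1,\dots,n-k\}$: reject the first $t-1$ items; let $s_1 > \dots > s_k$ be the $k$ best of them; the $j$-th accepted item is the first item arriving after the $(j-1)$-th accept (or after the sampling phase, for $j=1$) that is better than $s_{k-j+1}$. -}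

module Defs where

open import Data.Nat using (ℕ; zero; suc; _+_; _∸_; _<_; _≤_; _<?_)
open import Data.Nat.Properties using (≤-decTotalOrder; _≟_)
open import Data.List using (List; []; _∷_; map; concatMap; take; drop; filter; length; upTo)
open import Data.List.Relation.Unary.Unique.Propositional using (Unique)
open import Data.List.Relation.Unary.Unique.DecPropositional _≟_ using (unique?)
open import Data.List.Sort.InsertionSort.Base ≤-decTotalOrder using (sort)
open import Relation.Nullary.Decidable using (does)
open import Data.List.Relation.Unary.Any using (any?)
open import Data.Bool using (Bool; true; false; if_then_else_)

-- Items are identified by their rank: item i (0-indexed) has value v_{i+1};
-- a smaller rank means a better (larger) value.  An arrival order is a list
-- of ranks; position 0 arrives first.

allSeqs : ℕ → ℕ → List (List ℕ)
allSeqs zero    n = [] ∷ []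
allSeqs (suc m) n = concatMap (λ x → map (x ∷_) (allSeqs m n)) (upTo n)

orders : ℕ → List (List ℕ)
orders n = filter unique? (allSeqs n n)

-- 0-indexed lookup with default 0 (never used out of range below).
nth : List ℕ → ℕ → ℕ
nth []       _       = 0
nth (x ∷ xs) zero    = x
nth (x ∷ xs) (suc j) = nth xs j

run : (k : ℕ) → (thr : ℕ → ℕ) → (j : ℕ) → List ℕ → List ℕ
run k thr j []       = []
run k thr j (x ∷ xs) =
  if does (j <? k)
  then (if does (x <? thr j) then x ∷ run k thr (suc j) xs else run k thr j xs)
  else []

sortedSample : ℕ → List ℕ → List ℕ
sortedSample t σ = sort (take (t ∸ 1) σ)

-- SINGLE-REF(t, r): reject first t-1 items; s_r = r-th best of them;
-- accept the first k later items better than s_r.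
singleRef : (k t r : ℕ) → List ℕ → List ℕ
singleRef k t r σ = run k (λ _ → nth (sortedSample t σ) (r ∸ 1)) 0 (drop (t ∸ 1) σ)

-- OPTIMISTIC(t): reject first t-1 items; s_1 > … > s_k best k of them;
-- after j acceptances (j < k), the next accepted item is the first one
-- better than s_{k-j}  (the (j+1)-th accept uses s_{k-(j+1)+1}).
optimistic : (k t : ℕ) → List ℕ → List ℕ
optimistic k t σ = run k (λ j → nth (sortedSample t σ) (k ∸ j ∸ 1)) 0 (drop (t ∸ 1) σ)

-- Number of arrival orders (out of n!) in which the algorithm accepts item i.
-- p_i = acceptCount n alg i / n!.
acceptCount : (n : ℕ) → (List ℕ → List ℕ) → ℕ → ℕ
acceptCount n alg i = length (filter (λ σ → any? (_≟ i) (alg σ)) (orders n))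

-- Let τ exchange the items i and i+1 (ranks are 0-indexed).  Both algorithms accept
-- post-sample arrivals lying below thresholds that are order statistics of the sample;
-- we show that if i+1 is accepted under the arrival order σ, then i is accepted under
-- τ ∘ σ.  As σ ↦ τ ∘ σ permutes the arrival orders, p_{i+1} ≤ p_i follows.
-- An item x ∉ {i, i+1} lies below an order statistic of a sample S iff it lies below
-- the same order statistic of τ S, since both count the same elements ≤ x, while i+1
-- below one implies i below the other; so the two runs make the same decisions until
-- i+1, resp. i, arrives.  If i arrives after the sample, the sample is unchanged, no
-- threshold equals i+1, and i, i+1 lie on the same side of every threshold, so the
-- runs agree throughout up to exchanging i and i+1.

module Submission where

open import Defs
open import Data.Nat using (ℕ; zero; suc; _∸_; _+_; _≤_; _≰_; _<_; _≮_; _≥_; z≤n; s≤s; s≤s⁻¹; _≤?_; _<?_)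
open import Data.Nat.Properties
open import Data.Product using (_×_; _,_; proj₂)
open import Data.Sum using (_⊎_; inj₁; inj₂)
open import Data.List using (List; []; _∷_; map; filter; length; take; drop; upTo; _++_)
open import Data.List.Properties
  using (length-map; map-injective; ∷-injectiveˡ; ∷-injectiveʳ; filter-none; filter-accept; filter-reject;
         take-map; drop-map; map-id-local)
open import Data.List.Membership.Propositional using (_∈_; _∉_; find; lose)
open import Data.List.Membership.Propositional.Properties
open import Data.List.Membership.DecPropositional _≟_ using (_∈?_)
open import Data.List.Relation.Binary.Subset.Propositional using (_⊆_)
open import Data.List.Relation.Binary.Disjoint.Propositional using (Disjoint)
open import Data.List.Relation.Binary.Permutation.Propositional using (_↭_)
open import Data.List.Relation.Binary.Permutation.Propositional.Properties
  using (↭-length; filter-↭; ∈-resp-↭; shift)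
open import Data.List.Relation.Unary.Any as Any using (Any; here; there)
open import Data.List.Relation.Unary.All as All using (All; []; _∷_)
import Data.List.Relation.Unary.All.Properties as All
open import Data.List.Relation.Unary.AllPairs as AllPairs using (AllPairs; []; _∷_)
import Data.List.Relation.Unary.AllPairs.Properties as AllPairs
open import Data.List.Relation.Unary.Linked.Properties using (Linked⇒AllPairs)
open import Data.List.Relation.Unary.Unique.Propositional using (Unique)
import Data.List.Relation.Unary.Unique.Propositional.Properties as Unique
open import Data.List.Relation.Unary.Unique.DecPropositional _≟_ using (unique?)
open import Data.List.Sort.InsertionSort.Base ≤-decTotalOrder using (sort)
open import Data.List.Sort.InsertionSort.Properties ≤-decTotalOrder using (sort-↭; sort-↗)
open import Function using (_∘_; id; _⇔_; mk⇔; Equivalence)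
open import Relation.Binary.PropositionalEquality
open import Relation.Nullary using (Dec; yes; no; contradiction)
open import Relation.Nullary.Decidable using (dec-true; dec-false)
open import Relation.Unary using (Decidable)

transpose : ℕ → ℕ → ℕ
transpose i y with y ≟ i | y ≟ suc i
... | yes _ | _     = suc i
... | no _  | yes _ = i
... | no _  | no _  = y

data TransposeView (i y : ℕ) : ℕ → Set where
  at-i      : y ≡ i → TransposeView i y (suc i)
  at-suc-i  : y ≡ suc i → TransposeView i y i
  elsewhere : y ≢ i → y ≢ suc i → TransposeView i y y

transpose-view : ∀ i y → TransposeView i y (transpose i y)
transpose-view i y with y ≟ i | y ≟ suc i
... | yes p | _     = at-i p
... | no p  | yes q = at-suc-i q
... | no p  | no q  = elsewhere p q

transpose-i : ∀ i → transpose i i ≡ suc i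
transpose-i i with transpose i i | transpose-view i i
... | _ | at-i _          = refl
... | _ | at-suc-i i≡1+i  = contradiction i≡1+i (<⇒≢ (n<1+n i))
... | _ | elsewhere i≢i _ = contradiction refl i≢i

transpose-suc-i : ∀ i → transpose i (suc i) ≡ i
transpose-suc-i i with transpose i (suc i) | transpose-view i (suc i)
... | _ | at-i 1+i≡i            = contradiction (sym 1+i≡i) (<⇒≢ (n<1+n i))
... | _ | at-suc-i _            = refl
... | _ | elsewhere _ 1+i≢1+i = contradiction refl 1+i≢1+i

transpose-fixes : ∀ {i y} → y ≢ i → y ≢ suc i → transpose i y ≡ y
transpose-fixes {i} {y} y≢i y≢1+i with transpose i y | transpose-view i y
... | _ | at-i y≡i       = contradiction y≡i y≢i
... | _ | at-suc-i y≡1+i = contradiction y≡1+i y≢1+i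
... | _ | elsewhere _ _  = refl

transpose-involutive : ∀ i y → transpose i (transpose i y) ≡ y
transpose-involutive i y with transpose i y | transpose-view i y
... | _ | at-i refl             = transpose-suc-i i
... | _ | at-suc-i refl         = transpose-i i
... | _ | elsewhere y≢i y≢1+i = transpose-fixes y≢i y≢1+i

transpose-injective : ∀ i {x y} → transpose i x ≡ transpose i y → x ≡ y
transpose-injective i {x} {y} τx≡τy = begin
  x                             ≡⟨ transpose-involutive i x ⟨
  transpose i (transpose i x)   ≡⟨ cong (transpose i) τx≡τy ⟩
  transpose i (transpose i y)   ≡⟨ transpose-involutive i y ⟩
  y                             ∎
  where open ≡-Reasoning

transpose-< : ∀ {i n} y → suc i < n → y < n → transpose i y < n
transpose-< {i} y 1+i<n y<n with transpose i y | transpose-view i y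
... | _ | at-i _        = 1+i<n
... | _ | at-suc-i _    = <-trans (n<1+n i) 1+i<n
... | _ | elsewhere _ _ = y<n

map-transpose-involutive : ∀ i xs → map (transpose i) (map (transpose i) xs) ≡ xs
map-transpose-involutive i []       = refl
map-transpose-involutive i (y ∷ xs) =
  cong₂ _∷_ (transpose-involutive i y) (map-transpose-involutive i xs)

map-transpose-id : ∀ {i} xs → i ∉ xs → suc i ∉ xs → map (transpose i) xs ≡ xs
map-transpose-id xs i∉xs 1+i∉xs =
  map-id-local (All.tabulate λ x∈xs →
    transpose-fixes (λ { refl → i∉xs x∈xs }) (λ { refl → 1+i∉xs x∈xs }))

count≤ : ℕ → List ℕ → ℕ
count≤ x xs = length (filter (_≤? x) xs)

count≤-↭ : ∀ x {xs ys} → xs ↭ ys → count≤ x xs ≡ count≤ x ys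
count≤-↭ x xs↭ys = ↭-length (filter-↭ (_≤? x) xs↭ys)

count≤-sort : ∀ x xs → count≤ x (sort xs) ≡ count≤ x xs
count≤-sort x xs = count≤-↭ x (sort-↭ xs)

count≤-∷-≤ : ∀ {x y} xs → y ≤ x → count≤ x (y ∷ xs) ≡ suc (count≤ x xs)
count≤-∷-≤ {x} _ y≤x = cong length (filter-accept (_≤? x) y≤x)

count≤-∷-≰ : ∀ {x y} xs → y ≰ x → count≤ x (y ∷ xs) ≡ count≤ x xs
count≤-∷-≰ {x} _ y≰x = cong length (filter-reject (_≤? x) y≰x)

count≤-map : ∀ (f : ℕ → ℕ) {x x′} → (∀ y → f y ≤ x′ → y ≤ x) →
             ∀ xs → count≤ x′ (map f xs) ≤ count≤ x xs
count≤-map f h [] = z≤n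
count≤-map f {x} {x′} h (y ∷ xs) with f y ≤? x′ | y ≤? x
... | yes fy≤x′ | yes y≤x
  rewrite count≤-∷-≤ (map f xs) fy≤x′ | count≤-∷-≤ xs y≤x = s≤s (count≤-map f h xs)
... | yes fy≤x′ | no y≰x  = contradiction (h y fy≤x′) y≰x
... | no fy≰x′  | yes y≤x
  rewrite count≤-∷-≰ (map f xs) fy≰x′ | count≤-∷-≤ xs y≤x = m≤n⇒m≤1+n (count≤-map f h xs)
... | no fy≰x′  | no y≰x
  rewrite count≤-∷-≰ (map f xs) fy≰x′ | count≤-∷-≰ xs y≰x = count≤-map f h xs

count≤-below-all : ∀ {x xs} → All (x <_) xs → count≤ x xs ≡ 0
count≤-below-all x<xs = cong length (filter-none (_≤? _) (All.map <⇒≱ x<xs))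

nth-out-of-range : ∀ xs m → length xs ≤ m → nth xs m ≡ 0
nth-out-of-range []       m       _           = refl
nth-out-of-range (x ∷ xs) (suc m) (s≤s len≤m) = nth-out-of-range xs m len≤m

All-nth : ∀ {P : ℕ → Set} {xs} → All P xs → ∀ m → m < length xs → P (nth xs m)
All-nth (px ∷ _)  zero    _           = px
All-nth (_ ∷ pxs) (suc m) (s≤s m<len) = All-nth pxs m m<len

-- In a sorted list, nth xs m is the (m+1)-th smallest element, so x lies below
-- it exactly when at most m elements are ≤ x.
<nth⇒count≤ : ∀ {x xs} → AllPairs _≤_ xs → ∀ m → m < length xs → x < nth xs m → count≤ x xs ≤ m
<nth⇒count≤ {x} {a ∷ xs} (a≤xs ∷ _) zero _ x<a =
  ≤-reflexive (count≤-below-all (x<a ∷ All.map (<-≤-trans x<a) a≤xs))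
<nth⇒count≤ {x} {a ∷ xs} (a≤xs ∷ sorted) (suc m) (s≤s m<len) x<nth with a ≤? x
... | yes a≤x rewrite count≤-∷-≤ xs a≤x = s≤s (<nth⇒count≤ sorted m m<len x<nth)
... | no a≰x  rewrite count≤-below-all (≰⇒> a≰x ∷ All.map (<-≤-trans (≰⇒> a≰x)) a≤xs) = z≤n

count≤⇒<nth : ∀ {x xs} → AllPairs _≤_ xs → ∀ m → m < length xs → count≤ x xs ≤ m → x < nth xs m
count≤⇒<nth {x} {a ∷ xs} _ zero _ count≤0 with a ≤? x
... | no a≰x  = ≰⇒> a≰x
... | yes a≤x = contradiction (subst (_≤ 0) (count≤-∷-≤ xs a≤x) count≤0) λ ()
count≤⇒<nth {x} {a ∷ xs} (a≤xs ∷ sorted) (suc m) (s≤s m<len) count≤1+m with a ≤? x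
... | no a≰x  = <-≤-trans (≰⇒> a≰x) (All-nth a≤xs m m<len)
... | yes a≤x =
  count≤⇒<nth sorted m m<len (s≤s⁻¹ (subst (_≤ suc m) (count≤-∷-≤ xs a≤x) count≤1+m))

sort-sorted : ∀ xs → AllPairs _≤_ (sort xs)
sort-sorted xs = Linked⇒AllPairs ≤-trans (sort-↗ xs)

length-sort : ∀ xs → length (sort xs) ≡ length xs
length-sort xs = ↭-length (sort-↭ xs)

<nth-sort-map : ∀ (f : ℕ → ℕ) {x x′} xs m → (∀ y → f y ≤ x′ → y ≤ x) →
                x < nth (sort xs) m → x′ < nth (sort (map f xs)) m
<nth-sort-map f {x} {x′} xs m f-reflects x<nth with m <? length xs
... | yes m<|xs| = count≤⇒<nth (sort-sorted (map f xs)) m m<|sort-fxs| (begin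
    count≤ x′ (sort (map f xs)) ≡⟨ count≤-sort x′ (map f xs) ⟩
    count≤ x′ (map f xs)        ≤⟨ count≤-map f f-reflects xs ⟩
    count≤ x xs                 ≡⟨ count≤-sort x xs ⟨
    count≤ x (sort xs)          ≤⟨ <nth⇒count≤ (sort-sorted xs) m m<|sort-xs| x<nth ⟩
    m                           ∎)
  where
  open ≤-Reasoning
  m<|sort-xs| = subst (m <_) (sym (length-sort xs)) m<|xs|
  m<|sort-fxs| = subst (m <_) (sym (trans (length-sort (map f xs)) (length-map f xs))) m<|xs|
... | no m≮|xs| = contradiction (subst (x <_) (nth-out-of-range (sort xs) m |sort-xs|≤m) x<nth) λ ()
  where |sort-xs|≤m = subst (_≤ m) (sym (length-sort xs)) (≮⇒≥ m≮|xs|)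

nth-∈ : ∀ xs m → nth xs m ≡ 0 ⊎ nth xs m ∈ xs
nth-∈ []       m       = inj₁ refl
nth-∈ (x ∷ xs) zero    = inj₂ (here refl)
nth-∈ (x ∷ xs) (suc m) with nth-∈ xs m
... | inj₁ nth≡0   = inj₁ nth≡0
... | inj₂ nth∈xs  = inj₂ (there nth∈xs)

nth-sort-≢ : ∀ {y} xs m → suc y ∉ xs → nth (sort xs) m ≢ suc y
nth-sort-≢ xs m 1+y∉xs nth≡1+y with nth-∈ (sort xs) m
... | inj₁ nth≡0    = 0≢1+n (trans (sym nth≡0) nth≡1+y)
... | inj₂ nth∈sort = 1+y∉xs (∈-resp-↭ (sort-↭ xs) (subst (_∈ sort xs) nth≡1+y nth∈sort))

transpose-≤-fixed : ∀ {i x} → x ≢ i → x ≢ suc i → ∀ y → transpose i y ≤ x → y ≤ x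
transpose-≤-fixed {i} {x} x≢i _ y τy≤x with transpose i y | transpose-view i y
... | _ | at-i refl       = ≤-trans (n≤1+n i) τy≤x
... | _ | at-suc-i refl   = ≤∧≢⇒< τy≤x (x≢i ∘ sym)
... | _ | elsewhere _ _   = τy≤x

transpose-≤-i : ∀ i y → transpose i y ≤ i → y ≤ suc i
transpose-≤-i i y τy≤i with transpose i y | transpose-view i y
... | _ | at-i refl       = contradiction τy≤i (<⇒≱ (n<1+n i))
... | _ | at-suc-i refl   = ≤-refl
... | _ | elsewhere _ _   = m≤n⇒m≤1+n τy≤i

<nth-sort-transpose-⇔ : ∀ {i x} xs m → x ≢ i → x ≢ suc i →
                        x < nth (sort xs) m ⇔ transpose i x < nth (sort (map (transpose i) xs)) m
<nth-sort-transpose-⇔ {i} {x} xs m x≢i x≢1+i rewrite transpose-fixes x≢i x≢1+i =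
  mk⇔ (<nth-sort-map (transpose i) xs m (transpose-≤-fixed x≢i x≢1+i)) λ x<nth →
    subst (λ ys → x < nth (sort ys) m) (map-transpose-involutive i xs)
      (<nth-sort-map (transpose i) (map (transpose i) xs) m (transpose-≤-fixed x≢i x≢1+i) x<nth)

<-transpose-⇔ : ∀ {i x c} → c ≢ suc i → x ≢ suc i → x < c ⇔ transpose i x < c
<-transpose-⇔ {i} {x} c≢1+i x≢1+i with transpose i x | transpose-view i x
... | _ | at-i refl        = mk⇔ (λ i<c → ≤∧≢⇒< i<c (c≢1+i ∘ sym)) (<-trans (n<1+n i))
... | _ | at-suc-i x≡1+i   = contradiction x≡1+i x≢1+i
... | _ | elsewhere _ _    = mk⇔ id id

run-stop : ∀ {k j} thr x xs → j ≮ k → run k thr j (x ∷ xs) ≡ []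
run-stop {k} {j} thr x xs j≮k rewrite dec-false (j <? k) j≮k = refl

run-accept : ∀ {k j x} thr xs → j < k → x < thr j → run k thr j (x ∷ xs) ≡ x ∷ run k thr (suc j) xs
run-accept {k} {j} {x} thr xs j<k x<thr
  rewrite dec-true (j <? k) j<k | dec-true (x <? thr j) x<thr = refl

run-reject : ∀ {k j x} thr xs → j < k → x ≮ thr j → run k thr j (x ∷ xs) ≡ run k thr j xs
run-reject {k} {j} {x} thr xs j<k x≮thr
  rewrite dec-true (j <? k) j<k | dec-false (x <? thr j) x≮thr = refl

run-⊆ : ∀ k thr j {y} xs → y ∈ run k thr j xs → y ∈ xs
run-⊆ k thr j (x ∷ xs) y∈run with j <? k
... | no j≮k = contradiction (subst (_ ∈_) (run-stop thr x xs j≮k) y∈run) λ ()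
... | yes j<k with x <? thr j
...   | no x≮thr  = there (run-⊆ k thr j xs (subst (_ ∈_) (run-reject thr xs j<k x≮thr) y∈run))
...   | yes x<thr with subst (_ ∈_) (run-accept thr xs j<k x<thr) y∈run
...     | here y≡x     = here y≡x
...     | there y∈rest = there (run-⊆ k thr (suc j) xs y∈rest)

module _ (k : ℕ) {thr thr′ : ℕ → ℕ} (f : ℕ → ℕ) {y : ℕ}
         (y-kept : ∀ j → y < thr j → f y < thr′ j) where

  run-transfer : ∀ j {xs} → All (λ x → x ≢ y → ∀ l → x < thr l ⇔ f x < thr′ l) xs →
                 y ∈ run k thr j xs → f y ∈ run k thr′ j (map f xs)
  run-transfer j {x ∷ xs} (agree ∷ agrees) y∈run with j <? k
  ... | no j≮k = contradiction (subst (_ ∈_) (run-stop thr x xs j≮k) y∈run) λ ()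
  ... | yes j<k with x ≟ y | x <? thr j | f x <? thr′ j
  ...   | yes refl | _ | yes fy<thr′
          rewrite run-accept thr′ (map f xs) j<k fy<thr′ = here refl
  ...   | yes refl | yes y<thr | no fy≮thr′ = contradiction (y-kept j y<thr) fy≮thr′
  ...   | yes refl | no y≮thr | no fy≮thr′
          rewrite run-reject thr′ (map f xs) j<k fy≮thr′ =
            run-transfer j agrees (subst (_ ∈_) (run-reject thr xs j<k y≮thr) y∈run)
  ...   | no x≢y | yes x<thr | no fx≮thr′ = contradiction (Equivalence.to (agree x≢y j) x<thr) fx≮thr′
  ...   | no x≢y | no x≮thr | yes fx<thr′ = contradiction (Equivalence.from (agree x≢y j) fx<thr′) x≮thr
  ...   | no x≢y | no x≮thr | no fx≮thr′
          rewrite run-reject thr′ (map f xs) j<k fx≮thr′ =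
            run-transfer j agrees (subst (_ ∈_) (run-reject thr xs j<k x≮thr) y∈run)
  ...   | no x≢y | yes x<thr | yes fx<thr′
          rewrite run-accept thr′ (map f xs) j<k fx<thr′
          with subst (_ ∈_) (run-accept thr xs j<k x<thr) y∈run
  ...     | here y≡x     = contradiction (sym y≡x) x≢y
  ...     | there y∈rest = there (run-transfer (suc j) agrees y∈rest)

-- singleRef k t r and optimistic k t are by definition thresholdAlgorithm k (t ∸ 1) idx
-- with idx j = r ∸ 1, resp. idx j = k ∸ j ∸ 1.
thresholdAlgorithm : (k T : ℕ) → (ℕ → ℕ) → List ℕ → List ℕ
thresholdAlgorithm k T idx σ = run k (λ j → nth (sort (take T σ)) (idx j)) 0 (drop T σ)

∈-drop⁻ : ∀ {A : Set} n {y : A} xs → y ∈ drop n xs → y ∈ xs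
∈-drop⁻ zero    xs       y∈drop = y∈drop
∈-drop⁻ (suc n) (x ∷ xs) y∈drop = there (∈-drop⁻ n xs y∈drop)

take-drop-disjoint : ∀ {A : Set} n {xs : List A} → Unique xs → Disjoint (take n xs) (drop n xs)
take-drop-disjoint (suc n) {x ∷ xs} (x∉xs ∷ _) (here refl , y∈drop) =
  All.lookup x∉xs (∈-drop⁻ n xs y∈drop) refl
take-drop-disjoint (suc n) {x ∷ xs} (_ ∷ unique) (there y∈take , y∈drop) =
  take-drop-disjoint n unique (y∈take , y∈drop)

thresholdAlgorithm-transpose : ∀ k T idx i {σ} → Unique σ →
  suc i ∈ thresholdAlgorithm k T idx σ → i ∈ thresholdAlgorithm k T idx (map (transpose i) σ)
thresholdAlgorithm-transpose k T idx i {σ} unique 1+i∈alg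
  rewrite take-map {f = transpose i} T σ | drop-map {f = transpose i} T σ
  = subst (_∈ run k thr′ 0 (map (transpose i) rest)) (transpose-suc-i i) (accepted (i ∈? rest))
  where
  sample rest : List ℕ
  sample = take T σ
  rest   = drop T σ

  thr thr′ : ℕ → ℕ
  thr  j = nth (sort sample) (idx j)
  thr′ j = nth (sort (map (transpose i) sample)) (idx j)

  1+i∈rest : suc i ∈ rest
  1+i∈rest = run-⊆ k thr 0 rest 1+i∈alg

  1+i∉sample : suc i ∉ sample
  1+i∉sample 1+i∈sample = take-drop-disjoint T unique (1+i∈sample , 1+i∈rest)

  i∉sample : i ∈ rest → i ∉ sample
  i∉sample i∈rest i∈sample = take-drop-disjoint T unique (i∈sample , i∈rest)

  1+i-kept : ∀ j → suc i < thr j → transpose i (suc i) < thr′ j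
  1+i-kept j 1+i<thr rewrite transpose-suc-i i =
    <nth-sort-map (transpose i) sample (idx j) (transpose-≤-i i) 1+i<thr

  1+i-kept-fixed : ∀ j → suc i < thr j → transpose i (suc i) < thr j
  1+i-kept-fixed j 1+i<thr rewrite transpose-suc-i i = <-trans (n<1+n i) 1+i<thr

  accepted : Dec (i ∈ rest) → transpose i (suc i) ∈ run k thr′ 0 (map (transpose i) rest)
  accepted (no i∉rest) =
    run-transfer k (transpose i) 1+i-kept 0 {rest}
      (All.tabulate λ x∈rest x≢1+i j →
         <nth-sort-transpose-⇔ sample (idx j) (λ { refl → i∉rest x∈rest }) x≢1+i)
      1+i∈alg
  accepted (yes i∈rest) =
    subst (λ S → transpose i (suc i) ∈ run k (λ j → nth (sort S) (idx j)) 0 (map (transpose i) rest))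
      (sym (map-transpose-id sample (i∉sample i∈rest) 1+i∉sample))
      (run-transfer k (transpose i) 1+i-kept-fixed 0 {rest}
        (All.tabulate λ _ x≢1+i j → <-transpose-⇔ (nth-sort-≢ sample (idx j) 1+i∉sample) x≢1+i)
        1+i∈alg)

∈-allSeqs⁻ : ∀ m n {σ} → σ ∈ allSeqs m n → length σ ≡ m × All (_< n) σ
∈-allSeqs⁻ zero    n (here refl) = refl , []
∈-allSeqs⁻ (suc m) n σ∈
  with x , x∈upTo , σ∈x∷ ← find (∈-concatMap⁻ (λ x → map (x ∷_) (allSeqs m n)) {xs = upTo n} σ∈)
  with τ , τ∈ , refl ← ∈-map⁻ (x ∷_) σ∈x∷
  with |τ|≡m , τ<n ← ∈-allSeqs⁻ m n τ∈
  = cong suc |τ|≡m , ∈-upTo⁻ x∈upTo ∷ τ<n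

∈-allSeqs⁺ : ∀ m n {σ} → length σ ≡ m → All (_< n) σ → σ ∈ allSeqs m n
∈-allSeqs⁺ zero    n {[]}    refl []           = here refl
∈-allSeqs⁺ (suc m) n {x ∷ σ} |σ|≡m (x<n ∷ σ<n) =
  ∈-concatMap⁺ (λ y → map (y ∷_) (allSeqs m n))
    (lose (∈-upTo⁺ x<n) (∈-map⁺ (x ∷_) (∈-allSeqs⁺ m n (suc-injective |σ|≡m) σ<n)))

allSeqs-unique : ∀ m n → Unique (allSeqs m n)
allSeqs-unique zero    n = [] ∷ []
allSeqs-unique (suc m) n =
  Unique.concat⁺
    (All.map⁺ (All.universal (λ _ → Unique.map⁺ ∷-injectiveʳ (allSeqs-unique m n)) (upTo n)))
    (AllPairs.map⁺ (AllPairs.map heads-disjoint (Unique.upTo⁺ n)))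
  where
  heads-disjoint : ∀ {x y} → x ≢ y → Disjoint (map (x ∷_) (allSeqs m n)) (map (y ∷_) (allSeqs m n))
  heads-disjoint x≢y (σ∈x∷ , σ∈y∷)
    with _ , _ , refl ← ∈-map⁻ _ σ∈x∷
    with _ , _ , eq ← ∈-map⁻ _ σ∈y∷ = x≢y (∷-injectiveˡ eq)

Unique⇒length-≤ : ∀ {A : Set} {xs ys : List A} → Unique xs → xs ⊆ ys → length xs ≤ length ys
Unique⇒length-≤ {xs = []} _ _ = z≤n
Unique⇒length-≤ {xs = x ∷ xs} (x∉xs ∷ unique) xs⊆ys
  with as , bs , refl ← ∈-∃++ (xs⊆ys (here refl)) = begin
    suc (length xs)         ≤⟨ s≤s (Unique⇒length-≤ unique xs⊆as++bs) ⟩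
    suc (length (as ++ bs)) ≡⟨ ↭-length (shift x as bs) ⟨
    length (as ++ x ∷ bs)   ∎
  where
  open ≤-Reasoning
  xs⊆as++bs : xs ⊆ as ++ bs
  xs⊆as++bs v∈xs with ∈-++⁻ as (xs⊆ys (there v∈xs))
  ... | inj₁ v∈as         = ∈-++⁺ˡ v∈as
  ... | inj₂ (here refl)  = contradiction refl (All.lookup x∉xs v∈xs)
  ... | inj₂ (there v∈bs) = ∈-++⁺ʳ as v∈bs

length-filter-≤-injection : ∀ {A : Set} {P Q : A → Set} (P? : Decidable P) (Q? : Decidable Q)
  {f : A → A} {xs} → Unique xs → (∀ {x y} → f x ≡ f y → x ≡ y) →
  (∀ {x} → x ∈ xs → P x → f x ∈ xs × Q (f x)) →
  length (filter P? xs) ≤ length (filter Q? xs)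
length-filter-≤-injection P? Q? {f} {xs} unique f-injective f-maps = begin
  length (filter P? xs)         ≡⟨ length-map f (filter P? xs) ⟨
  length (map f (filter P? xs)) ≤⟨ Unique⇒length-≤ image-unique image⊆ ⟩
  length (filter Q? xs)         ∎
  where
  open ≤-Reasoning
  image-unique : Unique (map f (filter P? xs))
  image-unique = Unique.map⁺ f-injective (Unique.filter⁺ P? unique)

  image⊆ : map f (filter P? xs) ⊆ filter Q? xs
  image⊆ v∈image with x , x∈filter , refl ← ∈-map⁻ f v∈image
    with x∈xs , px ← ∈-filter⁻ P? x∈filter
    with fx∈xs , qfx ← f-maps x∈xs px = ∈-filter⁺ Q? fx∈xs qfx

∈-orders⁻ : ∀ n {σ} → σ ∈ orders n → σ ∈ allSeqs n n × Unique σ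
∈-orders⁻ n = ∈-filter⁻ unique? {xs = allSeqs n n}

map-transpose-∈-orders : ∀ {n i σ} → suc i < n → σ ∈ orders n → map (transpose i) σ ∈ orders n
map-transpose-∈-orders {n} {i} {σ} 1+i<n σ∈orders
  with σ∈allSeqs , unique ← ∈-orders⁻ n σ∈orders
  with |σ|≡n , σ<n ← ∈-allSeqs⁻ n n σ∈allSeqs
  = ∈-filter⁺ unique?
      (∈-allSeqs⁺ n n (trans (length-map (transpose i) σ) |σ|≡n)
        (All.map⁺ (All.map (λ {y} → transpose-< y 1+i<n) σ<n)))
      (Unique.map⁺ (transpose-injective i) unique)

acceptCount-transpose : ∀ n alg i → suc i < n →
  (∀ {σ} → Unique σ → suc i ∈ alg σ → i ∈ alg (map (transpose i) σ)) →
  acceptCount n alg (suc i) ≤ acceptCount n alg i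
acceptCount-transpose n alg i 1+i<n accepts-transposed =
  length-filter-≤-injection _ _ (Unique.filter⁺ unique? {allSeqs n n} (allSeqs-unique n n))
    (map-injective (transpose-injective i)) maps
  where
  maps : ∀ {σ} → σ ∈ orders n → Any (_≡ suc i) (alg σ) →
         map (transpose i) σ ∈ orders n × Any (_≡ i) (alg (map (transpose i) σ))
  maps σ∈orders 1+i∈alg =
    map-transpose-∈-orders 1+i<n σ∈orders ,
    Any.map sym (accepts-transposed (proj₂ (∈-orders⁻ n σ∈orders)) (Any.map sym 1+i∈alg))

lemma4 : (n k t : ℕ) → k + 1 ≤ t → t ≤ n ∸ k →
    ((r : ℕ) → 1 ≤ r → r ≤ k → (i : ℕ) → suc i < n →
      acceptCount n (singleRef k t r) i ≥ acceptCount n (singleRef k t r) (suc i))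
    ×
    ((i : ℕ) → suc i < n →
      acceptCount n (optimistic k t) i ≥ acceptCount n (optimistic k t) (suc i))
lemma4 n k t _ _ =
    (λ r _ _ i 1+i<n → acceptCount-transpose n (singleRef k t r) i 1+i<n
                          (thresholdAlgorithm-transpose k (t ∸ 1) (λ _ → r ∸ 1) i))
  , (λ i 1+i<n → acceptCount-transpose n (optimistic k t) i 1+i<n
                    (thresholdAlgorithm-transpose k (t ∸ 1) (λ j → k ∸ j ∸ 1) i))
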